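{- In Boolean Level Theory $\mathsf{BLT}$: for all sets $a,b$, $a\in b$ if and only if $-a\notin -b$, where $-$ is the negative operation.
   Context: $\mathsf{BLT}$: classical second-order logic with Comprehension, sole primitive $\in$. $\overline{a}=\{x:x\notin a\}$. $\mathrm{bpot}(a)=\{x:\exists c(c\in a\land c\notin c\land(x\subseteq c\lor\overline{x}\subseteq c))\}$. $h$ is a boolean-history iff $h\notin h$ and $x=\mathrm{bpot}(x\cap h)$ for all $x\in h$; $s$ is a boolean-level iff $s=\mathrm{bpot}(h)$ for a boolean-history $h$. Axioms: Extensionality; Complements $\forall a\exists c(c=\overline a\land(a\notin a\leftrightarrow c\in c))$; Separation$_\notin$ $\forall F\forall a(a\notin a\to\exists b(b\notin b\land\forall x(x\in b\leftrightarrow(F(x)\land x\in a))))$; Stratification$_\notin$: every non-self-membered set is a subset of some boolean-level. In $\mathsf{BLT}$ the boolean-levels are well-ordered by $\in$, which licenses definition by recursion along them. The negative $-a$ is defined recursively by: $-a=\overline{\{ -x:x\in a\}}$ if $a\notin a$, and $-a=\{ -x:x\notin a\}$ if $a\in a$. -}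

module Defs where

open import Data.Product using (Σ; ∃; ∃-syntax; _×_; _,_)
open import Data.Sum using (_⊎_)
open import Relation.Nullary using (¬_)
open import Relation.Binary.PropositionalEquality using (_≡_)
open import Function.Bundles using (_⇔_)

module Notions {V : Set} (_∈_ : V → V → Set) where

  _∉_ : V → V → Set
  x ∉ a = ¬ (x ∈ a)

  _⊆_ : V → V → Set
  x ⊆ c = ∀ y → y ∈ x → y ∈ c

  _co⊆_ : V → V → Set
  x co⊆ c = ∀ y → y ∉ x → y ∈ c

  IsComplement : V → V → Set
  IsComplement c a = ∀ x → (x ∈ c) ⇔ (x ∉ a)

  IsBpotOf : (V → Set) → V → Set
  IsBpotOf A s = ∀ x → (x ∈ s) ⇔ (∃[ c ] (A c × c ∉ c × (x ⊆ c ⊎ x co⊆ c)))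

  BooleanHistory : V → Set
  BooleanHistory h = h ∉ h × (∀ x → x ∈ h → IsBpotOf (λ c → c ∈ x × c ∈ h) x)

  BooleanLevel : V → Set
  BooleanLevel s = ∃[ h ] (BooleanHistory h × IsBpotOf (λ c → c ∈ h) s)

  -- neg satisfies the recursive defining equations of the negative:
  --   -a = \overline{{-x : x ∈ a}}  if a ∉ a
  --   -a = {-x : x ∉ a}             if a ∈ a
  IsNegative : (V → V) → Set
  IsNegative neg =
    ∀ a → (a ∉ a → ∀ y → (y ∈ neg a) ⇔ (¬ (∃[ x ] (x ∈ a × y ≡ neg x))))
        × (a ∈ a → ∀ y → (y ∈ neg a) ⇔ (∃[ x ] (x ∉ a × y ≡ neg x)))

-- A model of BLT (classical second-order logic with full Comprehension:
-- second-order variables range over all predicates V → Set).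
record BLT : Set₁ where
  field
    V   : Set
    _∈_ : V → V → Set
  open Notions _∈_ public
  field
    classical       : (P : Set) → P ⊎ ¬ P
    extensionality  : ∀ a b → (∀ x → (x ∈ a) ⇔ (x ∈ b)) → a ≡ b
    complements     : ∀ a → ∃[ c ] (IsComplement c a × ((a ∉ a) ⇔ (c ∈ c)))
    separation      : (F : V → Set) → ∀ a → a ∉ a →
                      ∃[ b ] (b ∉ b × (∀ x → (x ∈ b) ⇔ (F x × x ∈ a)))
    stratification  : ∀ a → a ∉ a → ∃[ s ] (BooleanLevel s × a ⊆ s)

{-# OPTIONS --safe #-}
-- Say z ≺ y when z is one of the sets y is built from: a member of y if y ∉ y, a non-member
-- if y ∈ y.  In a boolean-history every non-self-membered set has only ≺-accessible members
-- (a bad set would contain the intersection of all bad sets, itself bad, which Separation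
-- forbids), so members of boolean-levels are accessible; by Stratification the
-- ≺-predecessors of any set lie in a level, hence ≺ is well-founded.  Now -b is the image
-- of the ≺-predecessors of b under -, complemented when b ∉ b.  By ≺-induction -a never
-- lies in that image for a itself: when a and a predecessor w have the same polarity this
-- is the induction hypothesis for w, and otherwise the images for a and w would cover the
-- universe, contradicting Cantor's diagonal argument over a level containing both
-- predecessor sets.  Hence -a ∈ -a iff a ∉ a, then - is injective, and so -a ∈ -b holds
-- exactly when a is not ≺ b, which is the theorem.
module Submission where

open import Defs
open import Data.Empty using (⊥-elim)
open import Data.Product using (∃-syntax; _×_; _,_; proj₁; proj₂)
open import Data.Sum using (_⊎_; inj₁; inj₂; swap)
open import Function using (_∘_)
open import Function.Bundles using (_⇔_; mk⇔; Equivalence)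
open import Function.Construct.Symmetry using (⇔-sym)
open import Function.Properties.Equivalence using (⇔-setoid)
open import Function.Related.TypeIsomorphisms using (¬-cong-⇔)
open import Induction.WellFounded using (Acc; acc; WellFounded; module All)
open import Level using (0ℓ)
open import Relation.Nullary using (¬_)
open import Relation.Binary.PropositionalEquality using (_≡_; _≢_; refl; sym; subst)
import Relation.Binary.Reasoning.Setoid as SetoidReasoning

open Equivalence using (to; from)
module ⇔-Reasoning = SetoidReasoning (⇔-setoid 0ℓ)

module _ (M : BLT) where
  open BLT M

  ¬¬-elim : {P : Set} → ¬ ¬ P → P
  ¬¬-elim {P} ¬¬p with classical P
  ... | inj₁ p  = p
  ... | inj₂ ¬p = ⊥-elim (¬¬p ¬p)

  ¬¬⇔ : {P : Set} → (¬ ¬ P) ⇔ P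
  ¬¬⇔ = mk⇔ ¬¬-elim (λ p ¬p → ¬p p)

  polarity : ∀ a b → (a ∈ a ⇔ b ∈ b) ⊎ ((a ∉ a × b ∈ b) ⊎ (a ∈ a × b ∉ b))
  polarity a b with classical (a ∈ a) | classical (b ∈ b)
  ... | inj₁ a∈a | inj₁ b∈b = inj₁ (mk⇔ (λ _ → b∈b) (λ _ → a∈a))
  ... | inj₂ a∉a | inj₂ b∉b = inj₁ (mk⇔ (⊥-elim ∘ a∉a) (⊥-elim ∘ b∉b))
  ... | inj₂ a∉a | inj₁ b∈b = inj₂ (inj₁ (a∉a , b∈b))
  ... | inj₁ a∈a | inj₂ b∉b = inj₂ (inj₂ (a∈a , b∉b))

  ⊆-low : ∀ {x q} → q ∉ q → x ⊆ q → x ∉ x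
  ⊆-low {x} {q} q∉q x⊆q x∈x with separation (_∈ x) q q∉q
  ... | b , b∉b , b-spec = b∉b (subst (λ t → t ∈ t) (sym b≡x) x∈x)
    where
    b≡x : b ≡ x
    b≡x = extensionality b x λ w →
      mk⇔ (proj₁ ∘ to (b-spec w)) (λ w∈x → from (b-spec w) (w∈x , x⊆q w w∈x))

  co⊆-high : ∀ {x f} → f ∉ f → x co⊆ f → x ∈ x
  co⊆-high {x} f∉f x̄⊆f with complements x
  ... | c , c-spec , x∉x⇔c∈c =
    ¬¬-elim λ x∉x → ⊆-low f∉f (λ w → x̄⊆f w ∘ to (c-spec w)) (to x∉x⇔c∈c x∉x)

  _≺_ : V → V → Set
  z ≺ y = (y ∉ y × z ∈ y) ⊎ (y ∈ y × z ∉ y)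

  ∈⇔≺ : ∀ {z y} → y ∉ y → z ∈ y ⇔ z ≺ y
  ∈⇔≺ y∉y = mk⇔ (λ z∈y → inj₁ (y∉y , z∈y))
    λ { (inj₁ (_ , z∈y)) → z∈y ; (inj₂ (y∈y , _)) → ⊥-elim (y∉y y∈y) }

  ∉⇔≺ : ∀ {z y} → y ∈ y → z ∉ y ⇔ z ≺ y
  ∉⇔≺ y∈y = mk⇔ (λ z∉y → inj₂ (y∈y , z∉y))
    λ { (inj₁ (y∉y , _)) → ⊥-elim (y∉y y∈y) ; (inj₂ (_ , z∉y)) → z∉y }

  ∈⇔¬≺ : ∀ {z y} → y ∈ y → z ∈ y ⇔ (¬ z ≺ y)
  ∈⇔¬≺ {z} {y} y∈y = begin
    z ∈ y       ≈⟨ ⇔-sym ¬¬⇔ ⟩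
    (¬ z ∉ y)   ≈⟨ ¬-cong-⇔ (∉⇔≺ y∈y) ⟩
    (¬ z ≺ y)   ∎
    where open ⇔-Reasoning

  ≺-extensionality : ∀ {a b} → (a ∈ a ⇔ b ∈ b) → (∀ y → y ≺ a ⇔ y ≺ b) → a ≡ b
  ≺-extensionality {a} {b} a∈a⇔b∈b ≺a⇔≺b =
    extensionality a b λ y → same-members y (classical (a ∈ a))
    where
    open ⇔-Reasoning
    same-members : ∀ y → a ∈ a ⊎ a ∉ a → y ∈ a ⇔ y ∈ b
    same-members y (inj₁ a∈a) = begin
      y ∈ a     ≈⟨ ∈⇔¬≺ a∈a ⟩
      (¬ y ≺ a) ≈⟨ ¬-cong-⇔ (≺a⇔≺b y) ⟩
      (¬ y ≺ b) ≈⟨ ⇔-sym (∈⇔¬≺ (to a∈a⇔b∈b a∈a)) ⟩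
      y ∈ b     ∎
    same-members y (inj₂ a∉a) = begin
      y ∈ a     ≈⟨ ∈⇔≺ a∉a ⟩
      y ≺ a     ≈⟨ ≺a⇔≺b y ⟩
      y ≺ b     ≈⟨ ⇔-sym (∈⇔≺ (a∉a ∘ from a∈a⇔b∈b)) ⟩
      y ∈ b     ∎

  ≺-bounded : ∀ {y e z} → e ∉ e → y ⊆ e ⊎ y co⊆ e → z ≺ y → z ∈ e
  ≺-bounded e∉e (inj₁ y⊆e) (inj₁ (_ , z∈y))   = y⊆e _ z∈y
  ≺-bounded e∉e (inj₁ y⊆e) (inj₂ (y∈y , _))   = ⊥-elim (⊆-low e∉e y⊆e y∈y)
  ≺-bounded e∉e (inj₂ ȳ⊆e) (inj₁ (y∉y , _))   = ⊥-elim (y∉y (co⊆-high e∉e ȳ⊆e))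
  ≺-bounded e∉e (inj₂ ȳ⊆e) (inj₂ (_ , z∉y))   = ȳ⊆e _ z∉y

  AccMembers : V → Set
  AccMembers d = ∀ y → y ∈ d → Acc _≺_ y

  module _ {h : V} (hist : BooleanHistory h) where

    Bad : V → Set
    Bad d = d ∈ h × d ∉ d × ¬ AccMembers d

    bad-has-bad-member : ∀ {d} → Bad d → ∃[ e ] (e ∈ d × Bad e)
    bad-has-bad-member {d} (d∈h , _ , ¬acc) = ¬¬-elim λ none →
      ¬acc λ y y∈d → acc-from-witness (to (proj₂ hist d d∈h y) y∈d) none
      where
      acc-from-witness : ∀ {y} → ∃[ e ] ((e ∈ d × e ∈ h) × e ∉ e × (y ⊆ e ⊎ y co⊆ e)) →
                         ¬ (∃[ e ] (e ∈ d × Bad e)) → Acc _≺_ y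
      acc-from-witness (e , (e∈d , e∈h) , e∉e , y-bounded) none = acc λ z≺y →
        ¬¬-elim (λ ¬acc-e → none (e , e∈d , e∈h , e∉e , ¬acc-e)) _ (≺-bounded e∉e y-bounded z≺y)

    -- c is the intersection of all bad sets, cut out of d₀ by Separation: it is a subset of
    -- a bad member of each bad y, so it belongs to each bad y, and therefore to itself.
    ¬Bad : ∀ {d₀} → ¬ Bad d₀
    ¬Bad {d₀} bad₀@(_ , d₀∉d₀ , _) with separation (λ w → ∀ y → Bad y → w ∈ y) d₀ d₀∉d₀
    ... | c , c∉c , c-spec = c∉c (from (c-spec c) (c∈bad , c∈bad d₀ bad₀))
      where
      c∈bad : ∀ y → Bad y → c ∈ y
      c∈bad y bad with bad-has-bad-member bad
      ... | e , e∈y , e∈h , e∉e , ¬acc-e = from (proj₂ hist y (proj₁ bad) c)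
        (e , (e∈y , e∈h) , e∉e , inj₁ λ w w∈c → proj₁ (to (c-spec w) w∈c) e (e∈h , e∉e , ¬acc-e))

    history-AccMembers : ∀ {d} → d ∈ h → d ∉ d → AccMembers d
    history-AccMembers d∈h d∉d = ¬¬-elim λ ¬acc → ¬Bad (d∈h , d∉d , ¬acc)

    history-member-⊆-level : ∀ {s e} → IsBpotOf (_∈ h) s → e ∈ h → e ⊆ s
    history-member-⊆-level s-spec e∈h y y∈e with to (proj₂ hist _ e∈h y) y∈e
    ... | f , (_ , f∈h) , f∉f , y-bounded = from (s-spec y) (f , f∈h , f∉f , y-bounded)

  level-low : ∀ {s} → BooleanLevel s → s ∉ s
  level-low {s} (h , hist@(h∉h , _) , s-spec) s∈s with to (s-spec s) s∈s
  ... | e , e∈h , e∉e , inj₁ s⊆e =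
    e∉e (s⊆e e (from (s-spec e) (e , e∈h , e∉e , inj₁ λ _ w∈e → w∈e)))
  ... | e , e∈h , e∉e , inj₂ s̄⊆e with to (s-spec h) h∈s
    where
    h∈s : h ∈ s
    h∈s = ¬¬-elim λ h∉s → h∉s (history-member-⊆-level hist s-spec e∈h h (s̄⊆e h h∉s))
  ...   | f , f∈h , f∉f , inj₁ h⊆f = f∉f (h⊆f f f∈h)
  ...   | f , f∈h , f∉f , inj₂ h̄⊆f = h∉h (co⊆-high f∉f h̄⊆f)

  level-≺-closed : ∀ {s x z} → BooleanLevel s → x ∈ s → z ≺ x → z ∈ s
  level-≺-closed {x = x} (h , hist , s-spec) x∈s z≺x with to (s-spec x) x∈s
  ... | e , e∈h , e∉e , x-bounded =
    history-member-⊆-level hist s-spec e∈h _ (≺-bounded e∉e x-bounded z≺x)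

  level-member-acc : ∀ {s x} → BooleanLevel s → x ∈ s → Acc _≺_ x
  level-member-acc {x = x} (h , hist , s-spec) x∈s with to (s-spec x) x∈s
  ... | e , e∈h , e∉e , x-bounded =
    acc λ z≺x → history-AccMembers hist e∈h e∉e _ (≺-bounded e∉e x-bounded z≺x)

  ≺-predecessors-in-low-set : ∀ a → ∃[ A ] (A ∉ A × (∀ z → z ≺ a → z ∈ A))
  ≺-predecessors-in-low-set a with classical (a ∈ a)
  ... | inj₂ a∉a = a , a∉a , λ _ → from (∈⇔≺ a∉a)
  ... | inj₁ a∈a with complements a
  ...   | c , c-spec , a∉a⇔c∈c =
    c , (λ c∈c → from a∉a⇔c∈c c∈c a∈a) , λ z → from (c-spec z) ∘ from (∉⇔≺ a∈a)

  ≺-predecessors-in-level : ∀ a → ∃[ s ] (BooleanLevel s × (∀ z → z ≺ a → z ∈ s))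
  ≺-predecessors-in-level a with ≺-predecessors-in-low-set a
  ... | A , A∉A , ≺a⊆A with stratification A A∉A
  ...   | s , level , A⊆s = s , level , λ z → A⊆s z ∘ ≺a⊆A z

  ≺-wellFounded : WellFounded _≺_
  ≺-wellFounded a with ≺-predecessors-in-level a
  ... | s , level , ≺a⊆s = acc λ z≺a → level-member-acc level (≺a⊆s _ z≺a)

  ≺-induction : (P : V → Set) → (∀ a → (∀ {w} → w ≺ a → P w) → P a) → ∀ a → P a
  ≺-induction = All.wfRec ≺-wellFounded _

  cantor : (f : V → V) → ∀ {T} → T ∉ T → ∃[ y ] (∀ w → w ∈ T → y ≢ f w)
  cantor f {T} T∉T with separation (λ w → w ∉ f w) T T∉T
  ... | d , _ , d-spec = d , λ w w∈T d≡fw →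
    let w∉d : w ∉ d
        w∉d w∈d = proj₁ (to (d-spec w) w∈d) (subst (w ∈_) d≡fw w∈d)
    in  w∉d (from (d-spec w) ((λ w∈fw → w∉d (subst (w ∈_) (sym d≡fw) w∈fw)) , w∈T))

  module _ (neg : V → V) (isNeg : IsNegative neg) where

    NegImage : V → V → Set
    NegImage b y = ∃[ w ] (w ≺ b × y ≡ neg w)

    neg-low : ∀ {a y} → a ∉ a → y ∈ neg a ⇔ (¬ NegImage a y)
    neg-low {a} {y} a∉a = mk⇔
      (λ y∈-a (w , w≺a , y≡-w) → to (proj₁ (isNeg a) a∉a y) y∈-a (w , from (∈⇔≺ a∉a) w≺a , y≡-w))
      (λ ¬img → from (proj₁ (isNeg a) a∉a y)
                  λ (w , w∈a , y≡-w) → ¬img (w , to (∈⇔≺ a∉a) w∈a , y≡-w))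

    neg-high : ∀ {a y} → a ∈ a → y ∈ neg a ⇔ NegImage a y
    neg-high {a} {y} a∈a = mk⇔
      (λ y∈-a → let (w , w∉a , y≡-w) = to (proj₂ (isNeg a) a∈a y) y∈-a
                in  w , to (∉⇔≺ a∈a) w∉a , y≡-w)
      (λ (w , w≺a , y≡-w) → from (proj₂ (isNeg a) a∈a y) (w , from (∉⇔≺ a∈a) w≺a , y≡-w))

    same-polarity-NegImage : ∀ {a b y} → neg a ≡ neg b → (a ∈ a ⇔ b ∈ b) →
                             NegImage a y → NegImage b y
    same-polarity-NegImage {a} {b} {y} -a≡-b a∈a⇔b∈b img with classical (a ∈ a)
    ... | inj₁ a∈a = to (neg-high (to a∈a⇔b∈b a∈a)) (subst (y ∈_) -a≡-b (from (neg-high a∈a) img))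
    ... | inj₂ a∉a = ¬¬-elim λ ¬img →
      to (neg-low a∉a) (subst (y ∈_) (sym -a≡-b) (from (neg-low (a∉a ∘ from a∈a⇔b∈b)) ¬img)) img

    mixed-polarity-NegImage-cover : ∀ {a b} → neg a ≡ neg b → a ∉ a → b ∈ b →
                                    ∀ y → NegImage a y ⊎ NegImage b y
    mixed-polarity-NegImage-cover {a} -a≡-b a∉a b∈b y with classical (NegImage a y)
    ... | inj₁ img  = inj₁ img
    ... | inj₂ ¬img = inj₂ (to (neg-high b∈b) (subst (y ∈_) -a≡-b (from (neg-low a∉a) ¬img)))

    ¬NegImage-cover : ∀ {w a} → w ≺ a → ¬ (∀ y → NegImage w y ⊎ NegImage a y)
    ¬NegImage-cover {w} {a} w≺a cover with ≺-predecessors-in-level a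
    ... | s , level , ≺a⊆s with cantor neg (level-low level)
    ...   | y , y∉neg[s] with cover y
    ...     | inj₁ (u , u≺w , y≡-u) = y∉neg[s] u (level-≺-closed level (≺a⊆s w w≺a) u≺w) y≡-u
    ...     | inj₂ (u , u≺a , y≡-u) = y∉neg[s] u (≺a⊆s u u≺a) y≡-u

    neg-∉-own-NegImage : ∀ a → ¬ NegImage a (neg a)
    neg-∉-own-NegImage = ≺-induction _ step
      where
      step : ∀ a → (∀ {w} → w ≺ a → ¬ NegImage w (neg w)) → ¬ NegImage a (neg a)
      step a ih (w , w≺a , -a≡-w) with polarity a w
      ... | inj₁ same =
        ih w≺a (subst (NegImage w) -a≡-w (same-polarity-NegImage -a≡-w same (w , w≺a , -a≡-w)))
      ... | inj₂ (inj₁ (a∉a , w∈w)) =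
        ¬NegImage-cover w≺a (swap ∘ mixed-polarity-NegImage-cover -a≡-w a∉a w∈w)
      ... | inj₂ (inj₂ (a∈a , w∉w)) =
        ¬NegImage-cover w≺a (mixed-polarity-NegImage-cover (sym -a≡-w) w∉w a∈a)

    neg-∈-self⇔∉-self : ∀ a → neg a ∈ neg a ⇔ a ∉ a
    neg-∈-self⇔∉-self a = mk⇔
      (λ -a∈-a a∈a → neg-∉-own-NegImage a (to (neg-high a∈a) -a∈-a))
      (λ a∉a → from (neg-low a∉a) (neg-∉-own-NegImage a))

    neg-preserves-polarity : ∀ {a b} → neg a ≡ neg b → a ∈ a ⇔ b ∈ b
    neg-preserves-polarity -a≡-b = mk⇔ (transfer -a≡-b) (transfer (sym -a≡-b))
      where
      transfer : ∀ {a b} → neg a ≡ neg b → a ∈ a → b ∈ b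
      transfer {a} {b} -a≡-b a∈a = ¬¬-elim λ b∉b →
        let -a∈-a = subst (λ t → t ∈ t) (sym -a≡-b) (from (neg-∈-self⇔∉-self b) b∉b)
        in  to (neg-∈-self⇔∉-self a) -a∈-a a∈a

    neg-injective : ∀ {a b} → neg a ≡ neg b → a ≡ b
    neg-injective {a} = ≺-induction (λ a → ∀ {b} → neg a ≡ neg b → a ≡ b) step a
      where
      step : ∀ a → (∀ {w} → w ≺ a → ∀ {b} → neg w ≡ neg b → w ≡ b) →
             ∀ {b} → neg a ≡ neg b → a ≡ b
      step a ih {b} -a≡-b = ≺-extensionality same λ y → mk⇔ ≺a⇒≺b ≺b⇒≺a
        where
        same : a ∈ a ⇔ b ∈ b
        same = neg-preserves-polarity -a≡-b
        ≺a⇒≺b : ∀ {y} → y ≺ a → y ≺ b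
        ≺a⇒≺b {y} y≺a with same-polarity-NegImage -a≡-b same (y , y≺a , refl)
        ... | w , w≺b , -y≡-w = subst (_≺ b) (sym (ih y≺a -y≡-w)) w≺b
        ≺b⇒≺a : ∀ {y} → y ≺ b → y ≺ a
        ≺b⇒≺a {y} y≺b with same-polarity-NegImage (sym -a≡-b) (⇔-sym same) (y , y≺b , refl)
        ... | w , w≺a , -y≡-w = subst (_≺ a) (ih w≺a (sym -y≡-w)) w≺a

    NegImage-neg⇔≺ : ∀ {a b} → NegImage b (neg a) ⇔ a ≺ b
    NegImage-neg⇔≺ {a} {b} = mk⇔
      (λ (w , w≺b , -a≡-w) → subst (_≺ b) (sym (neg-injective -a≡-w)) w≺b)
      (λ a≺b → a , a≺b , refl)

    ∈⇔neg-∉ : ∀ a b → a ∈ b ⇔ neg a ∉ neg b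
    ∈⇔neg-∉ a b with classical (b ∈ b)
    ... | inj₁ b∈b = begin
      a ∈ b                      ≈⟨ ∈⇔¬≺ b∈b ⟩
      (¬ a ≺ b)                  ≈⟨ ¬-cong-⇔ (⇔-sym NegImage-neg⇔≺) ⟩
      (¬ NegImage b (neg a))     ≈⟨ ¬-cong-⇔ (⇔-sym (neg-high b∈b)) ⟩
      neg a ∉ neg b              ∎
      where open ⇔-Reasoning
    ... | inj₂ b∉b = begin
      a ∈ b                      ≈⟨ ∈⇔≺ b∉b ⟩
      a ≺ b                      ≈⟨ ⇔-sym NegImage-neg⇔≺ ⟩
      NegImage b (neg a)         ≈⟨ ⇔-sym ¬¬⇔ ⟩
      (¬ ¬ NegImage b (neg a))   ≈⟨ ¬-cong-⇔ (⇔-sym (neg-low b∉b)) ⟩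
      neg a ∉ neg b              ∎
      where open ⇔-Reasoning

theorem8 : (M : BLT) → (neg : BLT.V M → BLT.V M) → BLT.IsNegative M neg →
    ∀ a b → BLT._∈_ M a b ⇔ BLT._∉_ M (neg a) (neg b)
theorem8 = ∈⇔neg-∉
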